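{- Let $\mathcal{A}\le M(m,n,\mathbb{F}_p)$ be a matrix space of dimension $d\ge 1$, and let $L\in M(\alpha,m,\mathbb{F}_p)$, $R\in M(n,\beta,\mathbb{F}_p)$ for some positive integers $\alpha,\beta$. Let $\mathcal{Z}=\mathrm{zero}_{L,R}(\mathcal{A})$ and $z=\dim\mathcal{Z}$. If $z=0$ (i.e. $\mathcal{Z}$ contains only the zero matrix), then there is a unique semi-canonical basis of $\mathcal{A}$ with respect to $L$ and $R$. If $z>0$, then for any semi-canonical basis $(A_1,\dots,A_d)$ of $\mathcal{A}$ with respect to $L$ and $R$, $LA_iR$ is the zero matrix for all $1\le i\le z$ and $LA_iR$ is non-zero for all $z+1\le i\le d$; furthermore, if $(A_1,\dots,A_d)$ and $(A_1',\dots,A_d')$ are two semi-canonical bases of $\mathcal{A}$ with respect to $L$ and $R$, then for every $1\le i\le d$ we have $A_i=A_i'+A_i''$ for some $A_i''\in\mathcal{Z}$.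
   Context: $p$ is a prime and $M(a,b,\mathbb{F}_p)$ is the space of $a\times b$ matrices over $\mathbb{F}_p$; entries of $\mathbb{F}_p$ are identified with $\{0,\dots,p-1\}$ with the usual order. For $A,B\in M(a,b,\mathbb{F}_p)$, $A\prec B$ (lexically smaller) if there exist $q,r$ such that $A[i,j]=B[i,j]$ for all $i<q$ and all $j$, and for $i=q$, $j<r$, and $A[q,r]<B[q,r]$; $A\preceq B$ means $A\prec B$ or $A=B$. $\mathrm{zero}_{L,R}(\mathcal{A})$ is the linear space spanned by all $A\in\mathcal{A}$ with $LAR=0$. A tuple $(A_1,\dots,A_d)$ is a semi-canonical basis of $\mathcal{A}$ with respect to $L$ and $R$ if $\langle A_1,\dots,A_d\rangle=\mathcal{A}$ and, for each $1\le i\le d$, $LA_iR\preceq LAR$ for all $A\in\mathcal{A}$ not in $\langle A_1,\dots,A_{i-1}\rangle$ (here $\langle\cdot\rangle$ denotes linear span). -}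

module Defs where

open import Data.Nat as ℕ using (ℕ; zero; suc; NonZero)
open import Data.Nat.DivMod using (_mod_)
open import Data.Nat.Primality using (Prime; prime⇒nonZero)
open import Data.Fin as Fin using (Fin; toℕ)
open import Data.Vec using (Vec; []; _∷_; zipWith; tabulate; lookup; replicate; concat; foldr)
open import Data.Product using (Σ; ∃; _×_; _,_)
open import Data.Sum using (_⊎_)
open import Data.Empty using (⊥)
open import Relation.Binary.PropositionalEquality using (_≡_)
open import Relation.Nullary using (¬_)

module FF (p : ℕ) (pr : Prime p) where

  private
    instance
      nz : NonZero p
      nz = prime⇒nonZero pr

  𝔽 : Set
  𝔽 = Fin p

  0F : 𝔽
  0F = 0 mod p

  _+F_ : 𝔽 → 𝔽 → 𝔽
  a +F b = (toℕ a ℕ.+ toℕ b) mod p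

  _*F_ : 𝔽 → 𝔽 → 𝔽
  a *F b = (toℕ a ℕ.* toℕ b) mod p

  Mat : ℕ → ℕ → Set
  Mat a b = Vec (Vec 𝔽 b) a

  entry : ∀ {a b} → Mat a b → Fin a → Fin b → 𝔽
  entry A i j = lookup (lookup A i) j

  zeroM : ∀ {a b} → Mat a b
  zeroM = replicate _ (replicate _ 0F)

  _+M_ : ∀ {a b} → Mat a b → Mat a b → Mat a b
  A +M B = zipWith (zipWith _+F_) A B

  _·M_ : ∀ {a b} → 𝔽 → Mat a b → Mat a b
  c ·M A = Data.Vec.map (Data.Vec.map (c *F_)) A
    where import Data.Vec

  dot : ∀ {k} → Vec 𝔽 k → Vec 𝔽 k → 𝔽
  dot u v = foldr _ _+F_ 0F (zipWith _*F_ u v)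

  _⊗_ : ∀ {a b c} → Mat a b → Mat b c → Mat a c
  A ⊗ B = tabulate λ i → tabulate λ j → dot (lookup A i) (tabulate λ k → entry B k j)

  lincomb : ∀ {k a b} → (Fin k → 𝔽) → (Fin k → Mat a b) → Mat a b
  lincomb {zero}  c B = zeroM
  lincomb {suc k} c B = (c Fin.zero ·M B Fin.zero) +M lincomb (λ i → c (Fin.suc i)) (λ i → B (Fin.suc i))

  InSpan : ∀ {k a b} → (Fin k → Mat a b) → Mat a b → Set
  InSpan B A = ∃ λ c → lincomb c B ≡ A

  -- A ∈ ⟨B_j : j < i⟩  (span of the first toℕ i members of the tuple)
  InSpanPrefix : ∀ {k a b} → (Fin k → Mat a b) → Fin k → Mat a b → Set
  InSpanPrefix B i A = ∃ λ c → (∀ j → toℕ i ℕ.≤ toℕ j → c j ≡ 0F) × lincomb c B ≡ A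

  SpanOf : ∀ {a b} → (Mat a b → Set) → Mat a b → Set
  SpanOf S A = Σ ℕ λ k → Σ (Fin k → Mat _ _) λ B → (∀ i → S (B i)) × InSpan B A

  IsSubspace : ∀ {a b} → (Mat a b → Set) → Set
  IsSubspace 𝒜 = 𝒜 zeroM × (∀ A B → 𝒜 A → 𝒜 B → 𝒜 (A +M B)) × (∀ c A → 𝒜 A → 𝒜 (c ·M A))

  LinIndep : ∀ {k a b} → (Fin k → Mat a b) → Set
  LinIndep B = ∀ c → lincomb c B ≡ zeroM → ∀ i → c i ≡ 0F

  HasDim : ∀ {a b} → (Mat a b → Set) → ℕ → Set
  HasDim 𝒜 d = Σ (Fin d → Mat _ _) λ B → (∀ i → 𝒜 (B i)) × LinIndep B × (∀ A → 𝒜 A → InSpan B A)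

  LexLt : ∀ {k} → Vec 𝔽 k → Vec 𝔽 k → Set
  LexLt [] [] = ⊥
  LexLt (x ∷ xs) (y ∷ ys) = (x Fin.< y) ⊎ (x ≡ y × LexLt xs ys)

  _≺_ : ∀ {a b} → Mat a b → Mat a b → Set
  A ≺ B = LexLt (concat A) (concat B)

  _⪯_ : ∀ {a b} → Mat a b → Mat a b → Set
  A ⪯ B = A ≺ B ⊎ A ≡ B

  ZeroLR : ∀ {α m n β} → Mat α m → Mat n β → (Mat m n → Set) → Mat m n → Set
  ZeroLR L R 𝒜 = SpanOf (λ A → 𝒜 A × (L ⊗ A) ⊗ R ≡ zeroM)

  SemiCanonical : ∀ {α m n β d} → (Mat m n → Set) → Mat α m → Mat n β → (Fin d → Mat m n) → Set
  SemiCanonical 𝒜 L R B =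
    (∀ i → 𝒜 (B i)) × (∀ A → 𝒜 A → InSpan B A) ×
    (∀ i A → 𝒜 A → ¬ InSpanPrefix B i A → ((L ⊗ B i) ⊗ R) ⪯ ((L ⊗ A) ⊗ R))

-- The map A ↦ L A R is linear and its kernel on 𝒜 is zero_{L,R}(𝒜). In a semi-canonical basis B,
-- minimality forces L Bᵢ R = 0 as long as zero_{L,R}(𝒜) is not contained in ⟨Bⱼ : j < i⟩; comparing dimensions,
-- this happens exactly for the first z members, which therefore span zero_{L,R}(𝒜). For two semi-canonical bases
-- the prefix spans then agree modulo zero_{L,R}(𝒜), so by induction on i each L Bᵢ R is ⪯ the other: the images
-- coincide and the bases differ by members of zero_{L,R}(𝒜). When z = 0 the map is injective on 𝒜, which gives
-- uniqueness, and a basis is built greedily, each step taking the member of the finite space 𝒜 outside the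
-- previous span with lexicographically least image.

module Submission where

open import Defs
open import Algebra.Bundles using (CommutativeRing)
open import Algebra.Structures using (IsCommutativeRing)
import Algebra.Properties.Ring as RingProperties
import Algebra.Solver.Ring.NaturalCoefficients.Default as NaturalCoefficientsSolver
open import Data.Empty using (⊥; ⊥-elim)
open import Data.Fin as Fin using (Fin; toℕ; fromℕ<; inject≤; punchIn; funToFin; finToFun)
import Data.Fin.Induction as FinInduction
import Data.Fin.Properties as Finₚ
open import Data.Nat as ℕ using (ℕ; zero; suc; NonZero; _%_; _≤_; _<_; z≤n; s≤s)
import Data.Nat.Properties as ℕₚ
open import Data.Nat.Coprimality using (Coprime; coprime-Bézout)
open import Data.Nat.Divisibility using (∣⇒≤)
open import Data.Nat.DivMod using (_mod_; m<n⇒m%n≡m; m*n%n≡0; n%n≡0; %-distribˡ-+; %-distribˡ-*)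
open import Data.Nat.GCD using (module Bézout)
open import Data.Nat.Primality using (Prime; prime⇒nonZero; prime⇒nonTrivial; prime⇒irreducible)
open import Data.Product using (Σ; ∃; _×_; _,_; proj₁; proj₂)
open import Data.Sum using (_⊎_; inj₁; inj₂; [_,_]′)
open import Data.Vec as Vec using (Vec; []; _∷_; concat; replicate; zipWith; tabulate; lookup)
import Data.Vec.Properties as Vecₚ
open import Data.Vec.Functional as VecF using (updateAt)
open import Data.Vec.Functional.Properties using (updateAt-updates; updateAt-minimal)
open import Data.Vec.Relation.Unary.All as All using (All)
open import Data.Vec.Relation.Unary.All.Properties using (concat⁺)
open import Function using (_∘_; const)
import Induction.WellFounded as WF
open import Relation.Binary.Definitions using (tri<; tri≈; tri>)
open import Relation.Binary.PropositionalEquality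
open import Relation.Nullary using (¬_; Dec; yes; no; ¬?)
open import Relation.Nullary.Decidable using (_×-dec_; _→-dec_; decidable-stable)

module MatrixSpaces (p : ℕ) (pr : Prime p) where
  open FF p pr public

  instance
    p-nonZero : NonZero p
    p-nonZero = prime⇒nonZero pr

  private
    variable
      a b c k l s t : ℕ

  -- The prime field

  ι : ℕ → 𝔽
  ι n = n mod p

  toℕ-ι : ∀ n → toℕ (ι n) ≡ n % p
  toℕ-ι n = Finₚ.toℕ-fromℕ< _

  ι-cong-% : ∀ {m n} → m % p ≡ n % p → ι m ≡ ι n
  ι-cong-% {m} {n} e = Finₚ.toℕ-injective (trans (toℕ-ι m) (trans e (sym (toℕ-ι n))))

  ι-toℕ : ∀ x → ι (toℕ x) ≡ x
  ι-toℕ x = Finₚ.toℕ-injective (trans (toℕ-ι (toℕ x)) (m<n⇒m%n≡m (Finₚ.toℕ<n x)))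

  ι-+ : ∀ m n → ι m +F ι n ≡ ι (m ℕ.+ n)
  ι-+ m n = ι-cong-% (begin
    (toℕ (ι m) ℕ.+ toℕ (ι n)) % p  ≡⟨ cong₂ (λ x y → (x ℕ.+ y) % p) (toℕ-ι m) (toℕ-ι n) ⟩
    (m % p ℕ.+ n % p) % p          ≡⟨ %-distribˡ-+ m n p ⟨
    (m ℕ.+ n) % p                  ∎)
    where open ≡-Reasoning

  ι-* : ∀ m n → ι m *F ι n ≡ ι (m ℕ.* n)
  ι-* m n = ι-cong-% (begin
    (toℕ (ι m) ℕ.* toℕ (ι n)) % p  ≡⟨ cong₂ (λ x y → (x ℕ.* y) % p) (toℕ-ι m) (toℕ-ι n) ⟩
    (m % p ℕ.* (n % p)) % p        ≡⟨ %-distribˡ-* m n p ⟨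
    (m ℕ.* n) % p                  ∎)
    where open ≡-Reasoning

  ι-p : ι p ≡ 0F
  ι-p = ι-cong-% (trans (n%n≡0 p) (sym (m*n%n≡0 0 p)))

  toℕ-0F : toℕ 0F ≡ 0
  toℕ-0F = trans (toℕ-ι 0) (m*n%n≡0 0 p)

  1F : 𝔽
  1F = ι 1

  1<p : 1 < p
  1<p = ℕ.nonTrivial⇒n>1 p {{prime⇒nonTrivial pr}}

  toℕ-1F : toℕ 1F ≡ 1
  toℕ-1F = trans (toℕ-ι 1) (m<n⇒m%n≡m 1<p)

  -F_ : 𝔽 → 𝔽
  -F x = ι (p ℕ.∸ toℕ x)

  private
    lift₂ : ∀ {f g : ℕ → ℕ → ℕ} → (∀ m n → f m n ≡ g m n) → ∀ (x y : 𝔽) → ι (f (toℕ x) (toℕ y)) ≡ ι (g (toℕ x) (toℕ y))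
    lift₂ law x y = cong ι (law (toℕ x) (toℕ y))

    +F-comm : ∀ x y → x +F y ≡ y +F x
    +F-comm = lift₂ ℕₚ.+-comm

    *F-comm : ∀ x y → x *F y ≡ y *F x
    *F-comm = lift₂ ℕₚ.*-comm

    +F-assoc : ∀ x y z → (x +F y) +F z ≡ x +F (y +F z)
    +F-assoc x y z = begin
      (x +F y) +F z                     ≡⟨ cong ((x +F y) +F_) (ι-toℕ z) ⟨
      (x +F y) +F ι (toℕ z)             ≡⟨ ι-+ _ _ ⟩
      ι ((toℕ x ℕ.+ toℕ y) ℕ.+ toℕ z)   ≡⟨ cong ι (ℕₚ.+-assoc (toℕ x) _ _) ⟩
      ι (toℕ x ℕ.+ (toℕ y ℕ.+ toℕ z))   ≡⟨ ι-+ _ _ ⟨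
      ι (toℕ x) +F (y +F z)             ≡⟨ cong (_+F (y +F z)) (ι-toℕ x) ⟩
      x +F (y +F z)                     ∎
      where open ≡-Reasoning

    *F-assoc : ∀ x y z → (x *F y) *F z ≡ x *F (y *F z)
    *F-assoc x y z = begin
      (x *F y) *F z                     ≡⟨ cong ((x *F y) *F_) (ι-toℕ z) ⟨
      (x *F y) *F ι (toℕ z)             ≡⟨ ι-* _ _ ⟩
      ι ((toℕ x ℕ.* toℕ y) ℕ.* toℕ z)   ≡⟨ cong ι (ℕₚ.*-assoc (toℕ x) _ _) ⟩
      ι (toℕ x ℕ.* (toℕ y ℕ.* toℕ z))   ≡⟨ ι-* _ _ ⟨
      ι (toℕ x) *F (y *F z)             ≡⟨ cong (_*F (y *F z)) (ι-toℕ x) ⟩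
      x *F (y *F z)                     ∎
      where open ≡-Reasoning

    *F-distribˡ : ∀ x y z → x *F (y +F z) ≡ (x *F y) +F (x *F z)
    *F-distribˡ x y z = begin
      x *F (y +F z)                            ≡⟨ cong (_*F (y +F z)) (ι-toℕ x) ⟨
      ι (toℕ x) *F ι (toℕ y ℕ.+ toℕ z)         ≡⟨ ι-* _ _ ⟩
      ι (toℕ x ℕ.* (toℕ y ℕ.+ toℕ z))          ≡⟨ cong ι (ℕₚ.*-distribˡ-+ (toℕ x) (toℕ y) (toℕ z)) ⟩
      ι (toℕ x ℕ.* toℕ y ℕ.+ toℕ x ℕ.* toℕ z)  ≡⟨ ι-+ _ _ ⟨
      (x *F y) +F (x *F z)                     ∎
      where open ≡-Reasoning

    +F-identityˡ : ∀ x → 0F +F x ≡ x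
    +F-identityˡ x = trans (cong (λ n → ι (n ℕ.+ toℕ x)) toℕ-0F) (ι-toℕ x)

    *F-identityˡ : ∀ x → 1F *F x ≡ x
    *F-identityˡ x = trans (cong (λ n → ι (n ℕ.* toℕ x)) toℕ-1F) (trans (cong ι (ℕₚ.*-identityˡ (toℕ x))) (ι-toℕ x))

    -F-inverseʳ : ∀ x → x +F (-F x) ≡ 0F
    -F-inverseʳ x = begin
      x +F (-F x)                     ≡⟨ cong (_+F (-F x)) (ι-toℕ x) ⟨
      ι (toℕ x) +F ι (p ℕ.∸ toℕ x)    ≡⟨ ι-+ _ _ ⟩
      ι (toℕ x ℕ.+ (p ℕ.∸ toℕ x))     ≡⟨ cong ι (ℕₚ.m+[n∸m]≡n (ℕₚ.<⇒≤ (Finₚ.toℕ<n x))) ⟩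
      ι p                             ≡⟨ ι-p ⟩
      0F                              ∎
      where open ≡-Reasoning

  isCommutativeRing : IsCommutativeRing _≡_ _+F_ _*F_ -F_ 0F 1F
  isCommutativeRing = record
    { isRing = record
      { +-isAbelianGroup = record
        { isGroup = record
          { isMonoid = record
            { isSemigroup = record
              { isMagma = record { isEquivalence = isEquivalence ; ∙-cong = cong₂ _+F_ }
              ; assoc = +F-assoc }
            ; identity = +F-identityˡ , λ x → trans (+F-comm x 0F) (+F-identityˡ x) }
          ; inverse = (λ x → trans (+F-comm (-F x) x) (-F-inverseʳ x)) , -F-inverseʳ
          ; ⁻¹-cong = cong -F_ }
        ; comm = +F-comm }
      ; *-cong = cong₂ _*F_
      ; *-assoc = *F-assoc
      ; *-identity = *F-identityˡ , λ x → trans (*F-comm x 1F) (*F-identityˡ x)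
      ; distrib = *F-distribˡ , λ x y z → trans (*F-comm (y +F z) x) (trans (*F-distribˡ x y z) (cong₂ _+F_ (*F-comm x y) (*F-comm x z))) }
    ; *-comm = *F-comm }

  commutativeRing : CommutativeRing _ _
  commutativeRing = record { isCommutativeRing = isCommutativeRing }

  open CommutativeRing commutativeRing public
    using (_+_; _*_; -_; +-comm; +-assoc; +-identityˡ; +-identityʳ; -‿inverseʳ;
           *-comm; *-assoc; *-identityˡ; distribˡ; distribʳ; zeroˡ; zeroʳ; commutativeSemiring)
  open RingProperties (CommutativeRing.ring commutativeRing) public
    using (-‿distribˡ-*; -‿distribʳ-*; -‿involutive; -1*x≈-x; +-inverseʳ-unique; x∙y⁻¹≈ε⇒x≈y)

  module Solver = NaturalCoefficientsSolver commutativeSemiring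

  1F≢0F : 1F ≢ 0F
  1F≢0F e with trans (sym toℕ-1F) (trans (cong toℕ e) toℕ-0F)
  ... | ()

  toℕ-coprime : ∀ x → x ≢ 0F → Coprime (toℕ x) p
  toℕ-coprime x x≢0 {i} (i∣x , i∣p) with prime⇒irreducible pr i∣p
  ... | inj₁ i≡1 = i≡1
  ... | inj₂ refl = ⊥-elim (ℕₚ.<⇒≱ (Finₚ.toℕ<n x) (∣⇒≤ {{ℕ.≢-nonZero toℕx≢0}} i∣x))
    where
    toℕx≢0 : toℕ x ≢ 0
    toℕx≢0 e = x≢0 (Finₚ.toℕ-injective (trans e (sym toℕ-0F)))

  -- A Bézout identity for toℕ x and p, read modulo p.
  *-inverse : ∀ x → x ≢ 0F → ∃ λ y → y * x ≡ 1F
  *-inverse x x≢0 with coprime-Bézout (toℕ-coprime x x≢0)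
  ... | Bézout.+- u v eq = ι u , (begin
    ι u * x                 ≡⟨ cong (ι u *_) (ι-toℕ x) ⟨
    ι u * ι (toℕ x)         ≡⟨ ι-* u (toℕ x) ⟩
    ι (u ℕ.* toℕ x)         ≡⟨ cong ι eq ⟨
    ι (1 ℕ.+ v ℕ.* p)       ≡⟨ trans (cong (1F +_) (ι-* v p)) (ι-+ 1 (v ℕ.* p)) ⟨
    1F + ι v * ι p          ≡⟨ cong (λ t → 1F + ι v * t) ι-p ⟩
    1F + ι v * 0F           ≡⟨ trans (cong (1F +_) (zeroʳ (ι v))) (+-identityʳ 1F) ⟩
    1F                      ∎)
    where open ≡-Reasoning
  ... | Bézout.-+ u v eq = - ι u , (begin
    - ι u * x               ≡⟨ -‿distribˡ-* (ι u) x ⟨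
    - (ι u * x)             ≡⟨ cong -_ (+-inverseʳ-unique 1F (ι u * x) 1+ux≡0) ⟩
    - (- 1F)                ≡⟨ -‿involutive 1F ⟩
    1F                      ∎)
    where
    open ≡-Reasoning
    1+ux≡0 : 1F + ι u * x ≡ 0F
    1+ux≡0 = begin
      1F + ι u * x          ≡⟨ cong (λ t → 1F + ι u * t) (ι-toℕ x) ⟨
      1F + ι u * ι (toℕ x)  ≡⟨ trans (cong (1F +_) (ι-* u (toℕ x))) (ι-+ 1 _) ⟩
      ι (1 ℕ.+ u ℕ.* toℕ x) ≡⟨ cong ι eq ⟩
      ι (v ℕ.* p)           ≡⟨ ι-* v p ⟨
      ι v * ι p             ≡⟨ cong (ι v *_) ι-p ⟩
      ι v * 0F              ≡⟨ zeroʳ (ι v) ⟩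
      0F                    ∎

  -- Matrices as an 𝔽-vector space

  infixl 6 _⊞_ _⊟_
  infixr 7 _⊡_

  _⊞_ : Mat a b → Mat a b → Mat a b
  _⊞_ = _+M_

  _⊡_ : 𝔽 → Mat a b → Mat a b
  _⊡_ = _·M_

  _⊟_ : Mat a b → Mat a b → Mat a b
  A ⊟ B = A ⊞ (- 1F) ⊡ B

  entry-⊞ : ∀ (A B : Mat a b) i j → entry (A ⊞ B) i j ≡ entry A i j + entry B i j
  entry-⊞ A B i j = trans (cong (λ r → lookup r j) (Vecₚ.lookup-zipWith (zipWith _+F_) i A B))
                          (Vecₚ.lookup-zipWith _+F_ j (lookup A i) (lookup B i))

  entry-⊡ : ∀ x (A : Mat a b) i j → entry (x ⊡ A) i j ≡ x * entry A i j
  entry-⊡ x A i j = trans (cong (λ r → lookup r j) (Vecₚ.lookup-map i _ A)) (Vecₚ.lookup-map j _ (lookup A i))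

  entry-zeroM : ∀ i j → entry (zeroM {a} {b}) i j ≡ 0F
  entry-zeroM i j = trans (cong (λ r → lookup r j) (Vecₚ.lookup-replicate i _)) (Vecₚ.lookup-replicate j _)

  entry-⊗ : ∀ (A : Mat a b) (B : Mat b c) i j → entry (A ⊗ B) i j ≡ dot (lookup A i) (tabulate λ k → entry B k j)
  entry-⊗ A B i j = trans (cong (λ r → lookup r j) (Vecₚ.lookup∘tabulate _ i)) (Vecₚ.lookup∘tabulate _ j)

  ≡-by-lookup : ∀ {A : Set} {u v : Vec A k} → (∀ i → lookup u i ≡ lookup v i) → u ≡ v
  ≡-by-lookup {u = u} {v} e = trans (sym (Vecₚ.tabulate∘lookup u)) (trans (Vecₚ.tabulate-cong e) (Vecₚ.tabulate∘lookup v))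

  ≡-by-entries : ∀ {A B : Mat a b} → (∀ i j → entry A i j ≡ entry B i j) → A ≡ B
  ≡-by-entries e = ≡-by-lookup λ i → ≡-by-lookup (e i)

  ⊞-comm : ∀ (A B : Mat a b) → A ⊞ B ≡ B ⊞ A
  ⊞-comm A B = ≡-by-entries λ i j →
    trans (entry-⊞ A B i j) (trans (+-comm (entry A i j) _) (sym (entry-⊞ B A i j)))

  ⊞-assoc : ∀ (A B C : Mat a b) → (A ⊞ B) ⊞ C ≡ A ⊞ (B ⊞ C)
  ⊞-assoc A B C = ≡-by-entries λ i j → begin
    entry ((A ⊞ B) ⊞ C) i j                    ≡⟨ trans (entry-⊞ (A ⊞ B) C i j) (cong (_+ entry C i j) (entry-⊞ A B i j)) ⟩
    (entry A i j + entry B i j) + entry C i j  ≡⟨ +-assoc _ _ _ ⟩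
    entry A i j + (entry B i j + entry C i j)  ≡⟨ trans (entry-⊞ A (B ⊞ C) i j) (cong (entry A i j +_) (entry-⊞ B C i j)) ⟨
    entry (A ⊞ (B ⊞ C)) i j                    ∎
    where open ≡-Reasoning

  ⊞-identityˡ : ∀ (A : Mat a b) → zeroM ⊞ A ≡ A
  ⊞-identityˡ A = ≡-by-entries λ i j →
    trans (entry-⊞ zeroM A i j) (trans (cong (_+ entry A i j) (entry-zeroM i j)) (+-identityˡ _))

  ⊞-identityʳ : ∀ (A : Mat a b) → A ⊞ zeroM ≡ A
  ⊞-identityʳ A = trans (⊞-comm A zeroM) (⊞-identityˡ A)

  ⊞-interchange : ∀ (A B C D : Mat a b) → (A ⊞ B) ⊞ (C ⊞ D) ≡ (A ⊞ C) ⊞ (B ⊞ D)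
  ⊞-interchange A B C D = begin
    (A ⊞ B) ⊞ (C ⊞ D)  ≡⟨ ⊞-assoc A B (C ⊞ D) ⟩
    A ⊞ (B ⊞ (C ⊞ D))  ≡⟨ cong (A ⊞_) (⊞-assoc B C D) ⟨
    A ⊞ ((B ⊞ C) ⊞ D)  ≡⟨ cong (λ X → A ⊞ (X ⊞ D)) (⊞-comm B C) ⟩
    A ⊞ ((C ⊞ B) ⊞ D)  ≡⟨ cong (A ⊞_) (⊞-assoc C B D) ⟩
    A ⊞ (C ⊞ (B ⊞ D))  ≡⟨ ⊞-assoc A C (B ⊞ D) ⟨
    (A ⊞ C) ⊞ (B ⊞ D)  ∎
    where open ≡-Reasoning

  ⊡-distribˡ-⊞ : ∀ x (A B : Mat a b) → x ⊡ (A ⊞ B) ≡ x ⊡ A ⊞ x ⊡ B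
  ⊡-distribˡ-⊞ x A B = ≡-by-entries λ i j → begin
    entry (x ⊡ (A ⊞ B)) i j                    ≡⟨ trans (entry-⊡ x (A ⊞ B) i j) (cong (x *_) (entry-⊞ A B i j)) ⟩
    x * (entry A i j + entry B i j)            ≡⟨ distribˡ x _ _ ⟩
    x * entry A i j + x * entry B i j          ≡⟨ trans (entry-⊞ (x ⊡ A) (x ⊡ B) i j) (cong₂ _+_ (entry-⊡ x A i j) (entry-⊡ x B i j)) ⟨
    entry (x ⊡ A ⊞ x ⊡ B) i j                  ∎
    where open ≡-Reasoning

  ⊡-distribʳ-+ : ∀ x y (A : Mat a b) → (x + y) ⊡ A ≡ x ⊡ A ⊞ y ⊡ A
  ⊡-distribʳ-+ x y A = ≡-by-entries λ i j → begin
    entry ((x + y) ⊡ A) i j                    ≡⟨ entry-⊡ (x + y) A i j ⟩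
    (x + y) * entry A i j                      ≡⟨ distribʳ _ x y ⟩
    x * entry A i j + y * entry A i j          ≡⟨ trans (entry-⊞ (x ⊡ A) (y ⊡ A) i j) (cong₂ _+_ (entry-⊡ x A i j) (entry-⊡ y A i j)) ⟨
    entry (x ⊡ A ⊞ y ⊡ A) i j                  ∎
    where open ≡-Reasoning

  ⊡-assoc : ∀ x y (A : Mat a b) → (x * y) ⊡ A ≡ x ⊡ y ⊡ A
  ⊡-assoc x y A = ≡-by-entries λ i j → begin
    entry ((x * y) ⊡ A) i j    ≡⟨ entry-⊡ (x * y) A i j ⟩
    (x * y) * entry A i j      ≡⟨ *-assoc x y _ ⟩
    x * (y * entry A i j)      ≡⟨ trans (entry-⊡ x (y ⊡ A) i j) (cong (x *_) (entry-⊡ y A i j)) ⟨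
    entry (x ⊡ y ⊡ A) i j      ∎
    where open ≡-Reasoning

  ⊡-identityˡ : ∀ (A : Mat a b) → 1F ⊡ A ≡ A
  ⊡-identityˡ A = ≡-by-entries λ i j → trans (entry-⊡ 1F A i j) (*-identityˡ _)

  ⊡-zeroˡ : ∀ (A : Mat a b) → 0F ⊡ A ≡ zeroM
  ⊡-zeroˡ A = ≡-by-entries λ i j → trans (entry-⊡ 0F A i j) (trans (zeroˡ _) (sym (entry-zeroM i j)))

  ⊡-zeroʳ : ∀ x → x ⊡ zeroM {a} {b} ≡ zeroM
  ⊡-zeroʳ x = ≡-by-entries λ i j →
    trans (entry-⊡ x zeroM i j) (trans (cong (x *_) (entry-zeroM i j)) (trans (zeroʳ x) (sym (entry-zeroM i j))))

  ⊟-self : ∀ (A : Mat a b) → A ⊟ A ≡ zeroM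
  ⊟-self A = begin
    A ⊞ (- 1F) ⊡ A         ≡⟨ cong (_⊞ (- 1F) ⊡ A) (⊡-identityˡ A) ⟨
    1F ⊡ A ⊞ (- 1F) ⊡ A    ≡⟨ ⊡-distribʳ-+ 1F (- 1F) A ⟨
    (1F + - 1F) ⊡ A        ≡⟨ cong (_⊡ A) (-‿inverseʳ 1F) ⟩
    0F ⊡ A                 ≡⟨ ⊡-zeroˡ A ⟩
    zeroM                  ∎
    where open ≡-Reasoning

  B⊞[A⊟B]≡A : ∀ (A B : Mat a b) → B ⊞ (A ⊟ B) ≡ A
  B⊞[A⊟B]≡A A B = begin
    B ⊞ (A ⊞ (- 1F) ⊡ B)   ≡⟨ ⊞-assoc B A _ ⟨
    (B ⊞ A) ⊞ (- 1F) ⊡ B   ≡⟨ cong (_⊞ (- 1F) ⊡ B) (⊞-comm B A) ⟩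
    (A ⊞ B) ⊞ (- 1F) ⊡ B   ≡⟨ ⊞-assoc A B _ ⟩
    A ⊞ (B ⊟ B)            ≡⟨ cong (A ⊞_) (⊟-self B) ⟩
    A ⊞ zeroM              ≡⟨ ⊞-identityʳ A ⟩
    A                      ∎
    where open ≡-Reasoning

  A⊟B≡0⇒A≡B : ∀ (A B : Mat a b) → A ⊟ B ≡ zeroM → A ≡ B
  A⊟B≡0⇒A≡B A B e = trans (sym (B⊞[A⊟B]≡A A B)) (trans (cong (B ⊞_) e) (⊞-identityʳ B))

  dot-+ˡ : ∀ (u v w : Vec 𝔽 k) → dot (zipWith _+F_ u v) w ≡ dot u w + dot v w
  dot-+ˡ [] [] [] = sym (+-identityˡ 0F)
  dot-+ˡ (x ∷ u) (y ∷ v) (z ∷ w) = trans (cong ((x + y) * z +_) (dot-+ˡ u v w))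
    (solve 5 (λ x y z U V → (x :+ y) :* z :+ (U :+ V) := (x :* z :+ U) :+ (y :* z :+ V)) refl x y z (dot u w) (dot v w))
    where open Solver

  dot-*ˡ : ∀ x (u w : Vec 𝔽 k) → dot (Vec.map (x *F_) u) w ≡ x * dot u w
  dot-*ˡ x [] [] = sym (zeroʳ x)
  dot-*ˡ x (y ∷ u) (z ∷ w) = trans (cong ((x * y) * z +_) (dot-*ˡ x u w))
    (solve 4 (λ x y z U → x :* y :* z :+ x :* U := x :* (y :* z :+ U)) refl x y z (dot u w))
    where open Solver

  dot-+ʳ : ∀ (u : Vec 𝔽 k) f g → dot u (tabulate λ t → f t + g t) ≡ dot u (tabulate f) + dot u (tabulate g)
  dot-+ʳ [] f g = sym (+-identityˡ 0F)
  dot-+ʳ (x ∷ u) f g = trans (cong (x * (f Fin.zero + g Fin.zero) +_) (dot-+ʳ u (f ∘ Fin.suc) (g ∘ Fin.suc)))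
    (solve 5 (λ x y z U V → x :* (y :+ z) :+ (U :+ V) := (x :* y :+ U) :+ (x :* z :+ V)) refl x _ _ _ _)
    where open Solver

  dot-*ʳ : ∀ (u : Vec 𝔽 k) x f → dot u (tabulate λ t → x * f t) ≡ x * dot u (tabulate f)
  dot-*ʳ [] x f = sym (zeroʳ x)
  dot-*ʳ (y ∷ u) x f = trans (cong (y * (x * f Fin.zero) +_) (dot-*ʳ u x (f ∘ Fin.suc)))
    (solve 4 (λ y x z U → y :* (x :* z) :+ x :* U := x :* (y :* z :+ U)) refl y x _ _)
    where open Solver

  ⊗-distribˡ-⊞ : ∀ (L : Mat a b) (A B : Mat b c) → L ⊗ (A ⊞ B) ≡ L ⊗ A ⊞ L ⊗ B
  ⊗-distribˡ-⊞ L A B = ≡-by-entries λ i j → let Lᵢ = lookup L i in begin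
    entry (L ⊗ (A ⊞ B)) i j                             ≡⟨ entry-⊗ L (A ⊞ B) i j ⟩
    dot Lᵢ (tabulate λ k → entry (A ⊞ B) k j)           ≡⟨ cong (dot Lᵢ) (Vecₚ.tabulate-cong λ k → entry-⊞ A B k j) ⟩
    dot Lᵢ (tabulate λ k → entry A k j + entry B k j)   ≡⟨ dot-+ʳ Lᵢ _ _ ⟩
    dot Lᵢ (tabulate λ k → entry A k j) + dot Lᵢ (tabulate λ k → entry B k j)
                                                        ≡⟨ trans (entry-⊞ (L ⊗ A) (L ⊗ B) i j) (cong₂ _+_ (entry-⊗ L A i j) (entry-⊗ L B i j)) ⟨
    entry (L ⊗ A ⊞ L ⊗ B) i j                           ∎
    where open ≡-Reasoning

  ⊗-⊡ʳ : ∀ (L : Mat a b) x (A : Mat b c) → L ⊗ (x ⊡ A) ≡ x ⊡ (L ⊗ A)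
  ⊗-⊡ʳ L x A = ≡-by-entries λ i j → let Lᵢ = lookup L i in begin
    entry (L ⊗ (x ⊡ A)) i j                             ≡⟨ entry-⊗ L (x ⊡ A) i j ⟩
    dot Lᵢ (tabulate λ k → entry (x ⊡ A) k j)           ≡⟨ cong (dot Lᵢ) (Vecₚ.tabulate-cong λ k → entry-⊡ x A k j) ⟩
    dot Lᵢ (tabulate λ k → x * entry A k j)             ≡⟨ dot-*ʳ Lᵢ x _ ⟩
    x * dot Lᵢ (tabulate λ k → entry A k j)             ≡⟨ trans (entry-⊡ x (L ⊗ A) i j) (cong (x *_) (entry-⊗ L A i j)) ⟨
    entry (x ⊡ (L ⊗ A)) i j                             ∎
    where open ≡-Reasoning

  ⊗-distribʳ-⊞ : ∀ (A B : Mat a b) (R : Mat b c) → (A ⊞ B) ⊗ R ≡ A ⊗ R ⊞ B ⊗ R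
  ⊗-distribʳ-⊞ A B R = ≡-by-entries λ i j → let Rⱼ = tabulate λ k → entry R k j in begin
    entry ((A ⊞ B) ⊗ R) i j                             ≡⟨ entry-⊗ (A ⊞ B) R i j ⟩
    dot (lookup (A ⊞ B) i) Rⱼ                           ≡⟨ cong (λ r → dot r Rⱼ) (Vecₚ.lookup-zipWith _ i A B) ⟩
    dot (zipWith _+F_ (lookup A i) (lookup B i)) Rⱼ     ≡⟨ dot-+ˡ (lookup A i) (lookup B i) Rⱼ ⟩
    dot (lookup A i) Rⱼ + dot (lookup B i) Rⱼ           ≡⟨ trans (entry-⊞ (A ⊗ R) (B ⊗ R) i j) (cong₂ _+_ (entry-⊗ A R i j) (entry-⊗ B R i j)) ⟨
    entry (A ⊗ R ⊞ B ⊗ R) i j                           ∎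
    where open ≡-Reasoning

  ⊗-⊡ˡ : ∀ x (A : Mat a b) (R : Mat b c) → (x ⊡ A) ⊗ R ≡ x ⊡ (A ⊗ R)
  ⊗-⊡ˡ x A R = ≡-by-entries λ i j → let Rⱼ = tabulate λ k → entry R k j in begin
    entry ((x ⊡ A) ⊗ R) i j                             ≡⟨ entry-⊗ (x ⊡ A) R i j ⟩
    dot (lookup (x ⊡ A) i) Rⱼ                           ≡⟨ cong (λ r → dot r Rⱼ) (Vecₚ.lookup-map i _ A) ⟩
    dot (Vec.map (x *F_) (lookup A i)) Rⱼ               ≡⟨ dot-*ˡ x (lookup A i) Rⱼ ⟩
    x * dot (lookup A i) Rⱼ                             ≡⟨ trans (entry-⊡ x (A ⊗ R) i j) (cong (x *_) (entry-⊗ A R i j)) ⟨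
    entry (x ⊡ (A ⊗ R)) i j                             ∎
    where open ≡-Reasoning

  -- Linear combinations

  A⊞B≡0⇒A≡-B : ∀ (A B : Mat a b) → A ⊞ B ≡ zeroM → A ≡ (- 1F) ⊡ B
  A⊞B≡0⇒A≡-B A B e = begin
    A                       ≡⟨ ⊞-identityʳ A ⟨
    A ⊞ zeroM               ≡⟨ cong (A ⊞_) (⊟-self B) ⟨
    A ⊞ (B ⊟ B)             ≡⟨ ⊞-assoc A B _ ⟨
    (A ⊞ B) ⊞ (- 1F) ⊡ B    ≡⟨ cong (_⊞ (- 1F) ⊡ B) e ⟩
    zeroM ⊞ (- 1F) ⊡ B      ≡⟨ ⊞-identityˡ _ ⟩
    (- 1F) ⊡ B              ∎
    where open ≡-Reasoning

  x⊡Y⊞X≡0⇒Y≡κ⊡X : ∀ x (X Y : Mat a b) → x ≢ 0F → x ⊡ Y ⊞ X ≡ zeroM → ∃ λ κ → Y ≡ κ ⊡ X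
  x⊡Y⊞X≡0⇒Y≡κ⊡X x X Y x≢0 e with *-inverse x x≢0
  ... | y , yx≡1 = y * (- 1F) , (begin
    Y                   ≡⟨ ⊡-identityˡ Y ⟨
    1F ⊡ Y              ≡⟨ cong (_⊡ Y) yx≡1 ⟨
    (y * x) ⊡ Y         ≡⟨ ⊡-assoc y x Y ⟩
    y ⊡ x ⊡ Y           ≡⟨ cong (y ⊡_) (A⊞B≡0⇒A≡-B (x ⊡ Y) X e) ⟩
    y ⊡ (- 1F) ⊡ X      ≡⟨ ⊡-assoc y (- 1F) X ⟨
    (y * - 1F) ⊡ X      ∎)
    where open ≡-Reasoning

  lincomb-cong : ∀ {c c′ : Fin k → 𝔽} {B B′ : Fin k → Mat a b} → (∀ i → c i ⊡ B i ≡ c′ i ⊡ B′ i) →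
                 lincomb c B ≡ lincomb c′ B′
  lincomb-cong {k = zero}  e = refl
  lincomb-cong {k = suc k} e = cong₂ _⊞_ (e Fin.zero) (lincomb-cong (e ∘ Fin.suc))

  lincomb-congˡ : ∀ {c c′ : Fin k → 𝔽} (B : Fin k → Mat a b) → (∀ i → c i ≡ c′ i) → lincomb c B ≡ lincomb c′ B
  lincomb-congˡ B e = lincomb-cong λ i → cong (_⊡ B i) (e i)

  lincomb-zero : ∀ {c : Fin k → 𝔽} (B : Fin k → Mat a b) → (∀ i → c i ≡ 0F) → lincomb c B ≡ zeroM
  lincomb-zero {k = zero}  B e = refl
  lincomb-zero {k = suc k} B e =
    trans (cong₂ _⊞_ (trans (cong (_⊡ B Fin.zero) (e Fin.zero)) (⊡-zeroˡ _)) (lincomb-zero (B ∘ Fin.suc) (e ∘ Fin.suc)))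
          (⊞-identityˡ zeroM)

  lincomb-+ : ∀ (c c′ : Fin k → 𝔽) (B : Fin k → Mat a b) → lincomb (λ i → c i + c′ i) B ≡ lincomb c B ⊞ lincomb c′ B
  lincomb-+ {k = zero}  c c′ B = sym (⊞-identityˡ zeroM)
  lincomb-+ {k = suc k} c c′ B =
    trans (cong₂ _⊞_ (⊡-distribʳ-+ (c Fin.zero) (c′ Fin.zero) (B Fin.zero)) (lincomb-+ (c ∘ Fin.suc) (c′ ∘ Fin.suc) (B ∘ Fin.suc)))
          (⊞-interchange _ _ _ _)

  lincomb-* : ∀ x (c : Fin k → 𝔽) (B : Fin k → Mat a b) → lincomb (λ i → x * c i) B ≡ x ⊡ lincomb c B
  lincomb-* {k = zero}  x c B = sym (⊡-zeroʳ x)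
  lincomb-* {k = suc k} x c B =
    trans (cong₂ _⊞_ (⊡-assoc x (c Fin.zero) (B Fin.zero)) (lincomb-* x (c ∘ Fin.suc) (B ∘ Fin.suc)))
          (sym (⊡-distribˡ-⊞ x _ _))

  lincomb-closed : ∀ {S : Mat a b → Set} → IsSubspace S → (B : Fin k → Mat a b) → (∀ i → S (B i)) →
                   ∀ c → S (lincomb c B)
  lincomb-closed {k = zero}  (S0 , _) B SB c = S0
  lincomb-closed {k = suc k} S@(_ , S+ , S⊡) B SB c =
    S+ _ _ (S⊡ (c Fin.zero) _ (SB Fin.zero)) (lincomb-closed S (B ∘ Fin.suc) (SB ∘ Fin.suc) (c ∘ Fin.suc))

  InSpan-closed : ∀ {S : Mat a b → Set} → IsSubspace S → (B : Fin k → Mat a b) → (∀ i → S (B i)) →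
                  ∀ A → InSpan B A → S A
  InSpan-closed {S = S} sub B SB A (c , e) = subst S e (lincomb-closed sub B SB c)

  _[_]≔0 : (Fin k → 𝔽) → Fin k → Fin k → 𝔽
  c [ i ]≔0 = updateAt c i (const 0F)

  δ : Fin k → Fin k → 𝔽
  δ i = updateAt (const 0F) i (const 1F)

  lincomb-split : ∀ (c : Fin k → 𝔽) (B : Fin k → Mat a b) i → lincomb c B ≡ lincomb (c [ i ]≔0) B ⊞ c i ⊡ B i
  lincomb-split {a = a} {b = b} c B Fin.zero = begin
    C₀ ⊞ rest                   ≡⟨ ⊞-comm C₀ rest ⟩
    rest ⊞ C₀                   ≡⟨ cong (_⊞ C₀) (⊞-identityˡ rest) ⟨
    (zeroM ⊞ rest) ⊞ C₀         ≡⟨ cong (λ X → (X ⊞ rest) ⊞ C₀) (⊡-zeroˡ (B Fin.zero)) ⟨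
    (0F ⊡ B Fin.zero ⊞ rest) ⊞ C₀ ∎
    where
    open ≡-Reasoning
    C₀ rest : Mat a b
    C₀ = c Fin.zero ⊡ B Fin.zero
    rest = lincomb (c ∘ Fin.suc) (B ∘ Fin.suc)
  lincomb-split c B (Fin.suc i) =
    trans (cong (c Fin.zero ⊡ B Fin.zero ⊞_) (lincomb-split (c ∘ Fin.suc) (B ∘ Fin.suc) i)) (sym (⊞-assoc _ _ _))

  lincomb-δ : ∀ (B : Fin k → Mat a b) i → lincomb (δ i) B ≡ B i
  lincomb-δ B Fin.zero = trans (cong₂ _⊞_ (⊡-identityˡ (B Fin.zero)) (lincomb-zero (B ∘ Fin.suc) λ _ → refl)) (⊞-identityʳ _)
  lincomb-δ B (Fin.suc i) = trans (cong₂ _⊞_ (⊡-zeroˡ (B Fin.zero)) (lincomb-δ (B ∘ Fin.suc) i)) (⊞-identityˡ _)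

  lincomb-punchIn : ∀ (c : Fin (suc k) → 𝔽) (B : Fin (suc k) → Mat a b) i → c i ≡ 0F →
                    lincomb c B ≡ lincomb (c ∘ punchIn i) (B ∘ punchIn i)
  lincomb-punchIn c B Fin.zero e =
    trans (cong (_⊞ lincomb (c ∘ Fin.suc) (B ∘ Fin.suc)) (trans (cong (_⊡ B Fin.zero) e) (⊡-zeroˡ _))) (⊞-identityˡ _)
  lincomb-punchIn {k = suc k} c B (Fin.suc i) e =
    cong (c Fin.zero ⊡ B Fin.zero ⊞_) (lincomb-punchIn (c ∘ Fin.suc) (B ∘ Fin.suc) i e)

  lincomb-≡-zero⇒member : ∀ (c : Fin k → 𝔽) (B : Fin k → Mat a b) i → c i ≢ 0F → lincomb c B ≡ zeroM →
                          ∃ λ κ → B i ≡ lincomb (λ j → κ * (c [ i ]≔0) j) B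
  lincomb-≡-zero⇒member c B i cᵢ≢0 e with x⊡Y⊞X≡0⇒Y≡κ⊡X (c i) (lincomb (c [ i ]≔0) B) (B i) cᵢ≢0
                                              (trans (⊞-comm _ _) (trans (sym (lincomb-split c B i)) e))
  ... | κ , Bᵢ≡ = κ , trans Bᵢ≡ (sym (lincomb-* κ (c [ i ]≔0) B))

  lincomb-injective : ∀ {E : Fin k → Mat a b} → LinIndep E → ∀ c c′ → lincomb c E ≡ lincomb c′ E → ∀ i → c i ≡ c′ i
  lincomb-injective {E = E} indep c c′ e i =
    x∙y⁻¹≈ε⇒x≈y (c i) (c′ i) (trans (cong (c i +_) (sym (-1*x≈-x (c′ i)))) (indep _ c-c′≡0 i))
    where
    c-c′≡0 : lincomb (λ j → c j + (- 1F) * c′ j) E ≡ zeroM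
    c-c′≡0 = begin
      lincomb (λ j → c j + (- 1F) * c′ j) E    ≡⟨ lincomb-+ c _ E ⟩
      lincomb c E ⊞ lincomb (λ j → (- 1F) * c′ j) E ≡⟨ cong (lincomb c E ⊞_) (lincomb-* (- 1F) c′ E) ⟩
      lincomb c E ⊟ lincomb c′ E              ≡⟨ cong (lincomb c E ⊟_) e ⟨
      lincomb c E ⊟ lincomb c E               ≡⟨ ⊟-self _ ⟩
      zeroM                                   ∎
      where open ≡-Reasoning

  SupportBelow : ℕ → (Fin k → 𝔽) → Set
  SupportBelow t c = ∀ j → t ≤ toℕ j → c j ≡ 0F

  prefix : ∀ {X : Set} → t ≤ k → (Fin k → X) → Fin t → X
  prefix t≤k B j = B (inject≤ j t≤k)

  InSpanBelow : ℕ → (Fin k → Mat a b) → Mat a b → Set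
  InSpanBelow t B A = ∃ λ c → SupportBelow t c × lincomb c B ≡ A

  InSpanBelow-mono : s ≤ t → ∀ {B : Fin k → Mat a b} {A} → InSpanBelow s B A → InSpanBelow t B A
  InSpanBelow-mono s≤t (c , c<s , e) = c , (λ j t≤j → c<s j (ℕₚ.≤-trans s≤t t≤j)) , e

  InSpanBelow-member : ∀ (B : Fin k → Mat a b) {j} → toℕ j < t → InSpanBelow t B (B j)
  InSpanBelow-member {t = t} B {j} j<t = δ j , δⱼ<t , lincomb-δ B j
    where
    δⱼ<t : SupportBelow t (δ j)
    δⱼ<t l t≤l = updateAt-minimal l j (const 0F) λ l≡j → ℕₚ.<⇒≱ j<t (subst (λ x → t ≤ toℕ x) l≡j t≤l)

  extendByZero : t ≤ k → (Fin t → 𝔽) → Fin k → 𝔽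
  extendByZero {t = zero}  _   c j           = 0F
  extendByZero {t = suc t} _   c Fin.zero    = c Fin.zero
  extendByZero {t = suc t} t≤k c (Fin.suc j) = extendByZero (ℕ.s≤s⁻¹ t≤k) (c ∘ Fin.suc) j

  extendByZero-supportBelow : ∀ (t≤k : t ≤ k) c → SupportBelow t (extendByZero t≤k c)
  extendByZero-supportBelow {t = zero}  _   c j _ = refl
  extendByZero-supportBelow {t = suc t} t≤k c (Fin.suc j) (s≤s t≤j) =
    extendByZero-supportBelow (ℕ.s≤s⁻¹ t≤k) (c ∘ Fin.suc) j t≤j

  prefix-extendByZero : ∀ (t≤k : t ≤ k) c j → prefix t≤k (extendByZero t≤k c) j ≡ c j
  prefix-extendByZero {t = suc t} {k = suc k} t≤k c Fin.zero    = refl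
  prefix-extendByZero {t = suc t} {k = suc k} t≤k c (Fin.suc j) = prefix-extendByZero (ℕ.s≤s⁻¹ t≤k) (c ∘ Fin.suc) j

  lincomb-prefix : ∀ (t≤k : t ≤ k) {c : Fin k → 𝔽} (B : Fin k → Mat a b) → SupportBelow t c →
                   lincomb c B ≡ lincomb (prefix t≤k c) (prefix t≤k B)
  lincomb-prefix {t = zero}            t≤k B c<t = lincomb-zero B λ j → c<t j z≤n
  lincomb-prefix {t = suc t} {k = suc k} t≤k {c} B c<t =
    cong (c Fin.zero ⊡ B Fin.zero ⊞_) (lincomb-prefix (ℕ.s≤s⁻¹ t≤k) (B ∘ Fin.suc) λ j t≤j → c<t (Fin.suc j) (s≤s t≤j))

  lincomb-extendByZero : ∀ (t≤k : t ≤ k) c (B : Fin k → Mat a b) →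
                         lincomb (extendByZero t≤k c) B ≡ lincomb c (prefix t≤k B)
  lincomb-extendByZero t≤k c B = trans (lincomb-prefix t≤k B (extendByZero-supportBelow t≤k c))
                                       (lincomb-congˡ (prefix t≤k B) (prefix-extendByZero t≤k c))

  InSpanBelow⇒InSpan-prefix : ∀ (t≤k : t ≤ k) (B : Fin k → Mat a b) {A} → InSpanBelow t B A → InSpan (prefix t≤k B) A
  InSpanBelow⇒InSpan-prefix t≤k B (c , c<t , e) = prefix t≤k c , trans (sym (lincomb-prefix t≤k B c<t)) e

  InSpan-prefix⇒InSpanBelow : ∀ (t≤k : t ≤ k) (B : Fin k → Mat a b) {A} → InSpan (prefix t≤k B) A → InSpanBelow t B A
  InSpan-prefix⇒InSpanBelow t≤k B (c , e) =
    extendByZero t≤k c , extendByZero-supportBelow t≤k c , trans (lincomb-extendByZero t≤k c B) e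

  prefix-linIndep : ∀ (t≤k : t ≤ k) {B : Fin k → Mat a b} → LinIndep B → LinIndep (prefix t≤k B)
  prefix-linIndep t≤k {B} indep c e j =
    trans (sym (prefix-extendByZero t≤k c j)) (indep (extendByZero t≤k c) (trans (lincomb-extendByZero t≤k c B) e) _)

  InSpanBelow-isSubspace : ∀ t (B : Fin k → Mat a b) → IsSubspace (InSpanBelow t B)
  InSpanBelow-isSubspace t B =
    (const 0F , (λ _ _ → refl) , lincomb-zero B λ _ → refl) ,
    (λ X Y (c , c<t , eX) (c′ , c′<t , eY) → (λ j → c j + c′ j) ,
       (λ j t≤j → trans (cong₂ _+_ (c<t j t≤j) (c′<t j t≤j)) (+-identityˡ 0F)) ,
       trans (lincomb-+ c c′ B) (cong₂ _⊞_ eX eY)) ,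
    (λ x X (c , c<t , e) → (λ j → x * c j) ,
       (λ j t≤j → trans (cong (x *_) (c<t j t≤j)) (zeroʳ x)) ,
       trans (lincomb-* x c B) (cong (x ⊡_) e))

  InSpanBelow-⊆ : t ≤ k → ∀ {X Y : Fin k → Mat a b} → (∀ j → toℕ j < t → InSpanBelow t Y (X j)) →
                  ∀ {A} → InSpanBelow t X A → InSpanBelow t Y A
  InSpanBelow-⊆ {t = t} t≤k {X} {Y} X<t⊆⟨Y<t⟩ {A} A∈⟨X<t⟩ =
    InSpan-closed (InSpanBelow-isSubspace t Y) (prefix t≤k X) X′⊆⟨Y<t⟩ A (InSpanBelow⇒InSpan-prefix t≤k X A∈⟨X<t⟩)
    where
    X′⊆⟨Y<t⟩ : ∀ j → InSpanBelow t Y (prefix t≤k X j)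
    X′⊆⟨Y<t⟩ j = X<t⊆⟨Y<t⟩ _ (subst (_< t) (sym (Finₚ.toℕ-inject≤ j t≤k)) (Finₚ.toℕ<n j))

  -- Independence, spanning and dimension

  ∑ : (Fin k → 𝔽) → 𝔽
  ∑ = VecF.foldr _+_ 0F

  lincomb-lincomb : ∀ (c : Fin k → 𝔽) (E : Fin k → Mat a b) (B : Fin l → Mat a b) (co : Fin k → Fin l → 𝔽) →
                    (∀ j → lincomb (co j) B ≡ E j) → lincomb c E ≡ lincomb (λ t → ∑ λ j → c j * co j t) B
  lincomb-lincomb {k = zero}  c E B co e = sym (lincomb-zero B λ _ → refl)
  lincomb-lincomb {k = suc k} {l = l} c E B co e = begin
    c₀ ⊡ E Fin.zero ⊞ lincomb (c ∘ Fin.suc) (E ∘ Fin.suc)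
      ≡⟨ cong₂ (λ X Y → c₀ ⊡ X ⊞ Y) (sym (e Fin.zero)) (lincomb-lincomb (c ∘ Fin.suc) (E ∘ Fin.suc) B (co ∘ Fin.suc) (e ∘ Fin.suc)) ⟩
    c₀ ⊡ lincomb (co Fin.zero) B ⊞ lincomb rest B
      ≡⟨ cong (_⊞ lincomb rest B) (lincomb-* c₀ (co Fin.zero) B) ⟨
    lincomb (λ t → c₀ * co Fin.zero t) B ⊞ lincomb rest B
      ≡⟨ lincomb-+ _ rest B ⟨
    lincomb (λ t → ∑ λ j → c j * co j t) B ∎
    where
    open ≡-Reasoning
    c₀ : 𝔽
    c₀ = c Fin.zero
    rest : Fin l → 𝔽
    rest t = ∑ λ j → c (Fin.suc j) * co (Fin.suc j) t

  funToFin-cong : ∀ {f g : Fin k → 𝔽} → (∀ i → f i ≡ g i) → funToFin f ≡ funToFin g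
  funToFin-cong {k = zero}  e = refl
  funToFin-cong {k = suc k} e = cong₂ Fin.combine (e Fin.zero) (funToFin-cong (e ∘ Fin.suc))

  ^-cancelʳ-≤ : p ℕ.^ k ≤ p ℕ.^ l → k ≤ l
  ^-cancelʳ-≤ pᵏ≤pˡ = ℕₚ.≮⇒≥ λ l<k → ℕₚ.<⇒≱ (ℕₚ.^-monoʳ-< p 1<p l<k) pᵏ≤pˡ

  -- Steinitz: the p ^ k combinations of E are distinct, and each is one of the p ^ l combinations of B.
  steinitz : ∀ {E : Fin k → Mat a b} {B : Fin l → Mat a b} → LinIndep E → (∀ j → InSpan B (E j)) → k ≤ l
  steinitz {k = k} {l = l} {E = E} {B = B} indep E⊆B = ^-cancelʳ-≤ (Finₚ.injective⇒≤ recode-injective)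
    where
    co : Fin k → Fin l → 𝔽
    co j = proj₁ (E⊆B j)

    coordinates : (Fin k → 𝔽) → Fin l → 𝔽
    coordinates c t = ∑ λ j → c j * co j t

    coordinates-injective : ∀ c c′ → (∀ t → coordinates c t ≡ coordinates c′ t) → ∀ i → c i ≡ c′ i
    coordinates-injective c c′ e = lincomb-injective indep c c′ (begin
      lincomb c E                    ≡⟨ lincomb-lincomb c E B co (proj₂ ∘ E⊆B) ⟩
      lincomb (coordinates c) B      ≡⟨ lincomb-congˡ B e ⟩
      lincomb (coordinates c′) B     ≡⟨ lincomb-lincomb c′ E B co (proj₂ ∘ E⊆B) ⟨
      lincomb c′ E                   ∎)
      where open ≡-Reasoning

    decode : Fin (p ℕ.^ k) → Fin k → 𝔽
    decode = finToFun

    recode : Fin (p ℕ.^ k) → Fin (p ℕ.^ l)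
    recode x = funToFin (coordinates (decode x))

    recode-injective : ∀ {x y} → recode x ≡ recode y → x ≡ y
    recode-injective {x} {y} e = begin
      x                      ≡⟨ Finₚ.funToFin-finToFin {k} {p} x ⟨
      funToFin (decode x)    ≡⟨ funToFin-cong (coordinates-injective (decode x) (decode y) same-coordinates) ⟩
      funToFin (decode y)    ≡⟨ Finₚ.funToFin-finToFin {k} {p} y ⟩
      y                      ∎
      where
      open ≡-Reasoning
      same-coordinates : ∀ t → coordinates (decode x) t ≡ coordinates (decode y) t
      same-coordinates t = trans (sym (Finₚ.finToFun-funToFin _ t))
                                 (trans (cong (λ z → finToFun z t) e) (Finₚ.finToFun-funToFin _ t))

  _≟M_ : (A B : Mat a b) → Dec (A ≡ B)
  _≟M_ = Vecₚ.≡-dec (Vecₚ.≡-dec Finₚ._≟_)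

  ∃-coefficients? : (P : (Fin k → 𝔽) → Set) → (∀ {c c′} → (∀ i → c i ≡ c′ i) → P c → P c′) →
                    (∀ c → Dec (P c)) → Dec (∃ P)
  ∃-coefficients? P P-cong P? with Finₚ.any? (P? ∘ finToFun)
  ... | yes (x , Px) = yes (finToFun x , Px)
  ... | no ¬P        = no λ (c , Pc) → ¬P (funToFin c , P-cong (λ i → sym (Finₚ.finToFun-funToFin c i)) Pc)

  InSpan? : ∀ (B : Fin k → Mat a b) A → Dec (InSpan B A)
  InSpan? B A = ∃-coefficients? _ (λ c≗c′ e → trans (lincomb-congˡ B (sym ∘ c≗c′)) e) (λ c → lincomb c B ≟M A)

  InSpanBelow? : ∀ t (B : Fin k → Mat a b) A → Dec (InSpanBelow t B A)
  InSpanBelow? t B A = ∃-coefficients? _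
    (λ c≗c′ (c<t , e) → (λ j t≤j → trans (sym (c≗c′ j)) (c<t j t≤j)) , trans (lincomb-congˡ B (sym ∘ c≗c′)) e)
    (λ c → Finₚ.all? (λ j → (t ℕₚ.≤? toℕ j) →-dec (c j Finₚ.≟ 0F)) ×-dec (lincomb c B ≟M A))

  linIndep-∷ : ∀ {B : Fin k → Mat a b} {A} → LinIndep B → ¬ InSpan B A → LinIndep (A VecF.∷ B)
  linIndep-∷ {B = B} {A} indep A∉B c e = vanishes (c Fin.zero Finₚ.≟ 0F)
    where
    open ≡-Reasoning
    A∈B : (∃ λ κ → A ≡ κ ⊡ lincomb (c ∘ Fin.suc) B) → InSpan B A
    A∈B (κ , A≡) = (λ j → κ * c (Fin.suc j)) , trans (lincomb-* κ (c ∘ Fin.suc) B) (sym A≡)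
    tail≡0 : c Fin.zero ≡ 0F → lincomb (c ∘ Fin.suc) B ≡ zeroM
    tail≡0 c₀≡0 = begin
      lincomb (c ∘ Fin.suc) B                    ≡⟨ ⊞-identityˡ _ ⟨
      zeroM ⊞ lincomb (c ∘ Fin.suc) B            ≡⟨ cong (_⊞ lincomb (c ∘ Fin.suc) B) (trans (cong (_⊡ A) c₀≡0) (⊡-zeroˡ A)) ⟨
      c Fin.zero ⊡ A ⊞ lincomb (c ∘ Fin.suc) B   ≡⟨ e ⟩
      zeroM                                      ∎
    vanishes : Dec (c Fin.zero ≡ 0F) → ∀ j → c j ≡ 0F
    vanishes (no c₀≢0) = ⊥-elim (A∉B (A∈B (x⊡Y⊞X≡0⇒Y≡κ⊡X (c Fin.zero) _ A c₀≢0 e)))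
    vanishes (yes c₀≡0) Fin.zero    = c₀≡0
    vanishes (yes c₀≡0) (Fin.suc j) = indep (c ∘ Fin.suc) (tail≡0 c₀≡0) j

  linIndep⇒spanning : ∀ (B E : Fin k → Mat a b) → LinIndep B → (∀ j → InSpan E (B j)) → ∀ A → InSpan E A → InSpan B A
  linIndep⇒spanning B E indep B⊆E A A∈E = decidable-stable (InSpan? B A) λ A∉B →
    ℕₚ.<-irrefl refl (steinitz {E = A VecF.∷ B} (linIndep-∷ indep A∉B) λ where
      Fin.zero    → A∈E
      (Fin.suc j) → B⊆E j)

  InSpan-punchIn : ∀ (c : Fin (suc k) → 𝔽) (B : Fin (suc k) → Mat a b) i → c i ≢ 0F → lincomb c B ≡ zeroM →
                   ∀ {A} → InSpan B A → InSpan (B ∘ punchIn i) A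
  InSpan-punchIn {k = k} c B i cᵢ≢0 e {A} (a , A≡) = avoiding (lincomb-≡-zero⇒member c B i cᵢ≢0 e)
    where
    open ≡-Reasoning
    avoiding : (∃ λ κ → B i ≡ lincomb (λ j → κ * (c [ i ]≔0) j) B) → InSpan (B ∘ punchIn i) A
    avoiding (κ , Bᵢ≡) = a′ ∘ punchIn i , trans (sym (lincomb-punchIn a′ B i a′ᵢ≡0)) (begin
      lincomb a′ B                                         ≡⟨ lincomb-+ (a [ i ]≔0) (λ t → a i * d t) B ⟩
      lincomb (a [ i ]≔0) B ⊞ lincomb (λ t → a i * d t) B  ≡⟨ cong (lincomb (a [ i ]≔0) B ⊞_) (lincomb-* (a i) d B) ⟩
      lincomb (a [ i ]≔0) B ⊞ a i ⊡ lincomb d B            ≡⟨ cong (λ X → lincomb (a [ i ]≔0) B ⊞ a i ⊡ X) Bᵢ≡ ⟨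
      lincomb (a [ i ]≔0) B ⊞ a i ⊡ B i                    ≡⟨ lincomb-split a B i ⟨
      lincomb a B                                          ≡⟨ A≡ ⟩
      A                                                    ∎)
      where
      d a′ : Fin (suc k) → 𝔽
      d t = κ * (c [ i ]≔0) t
      a′ t = (a [ i ]≔0) t + a i * d t
      a′ᵢ≡0 : a′ i ≡ 0F
      a′ᵢ≡0 = begin
        (a [ i ]≔0) i + a i * (κ * (c [ i ]≔0) i)  ≡⟨ cong₂ (λ x y → x + a i * (κ * y)) (updateAt-updates i a) (updateAt-updates i c) ⟩
        0F + a i * (κ * 0F)                        ≡⟨ cong (λ x → 0F + a i * x) (zeroʳ κ) ⟩
        0F + a i * 0F                              ≡⟨ trans (cong (0F +_) (zeroʳ (a i))) (+-identityˡ 0F) ⟩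
        0F                                         ∎

  spanning⇒linIndep : ∀ (B E : Fin k → Mat a b) → LinIndep E → (∀ j → InSpan B (E j)) → LinIndep B
  spanning⇒linIndep {k = suc k} B E indep E⊆B c e i = decidable-stable (c i Finₚ.≟ 0F) λ cᵢ≢0 →
    ℕₚ.<-irrefl refl (steinitz indep λ j → InSpan-punchIn c B i cᵢ≢0 e (E⊆B j))

  linIndep⇒∉InSpanPrefix : ∀ {B : Fin k → Mat a b} → LinIndep B → ∀ i → ¬ InSpanPrefix B i (B i)
  linIndep⇒∉InSpanPrefix {B = B} indep i (c , c<i , e) = 1F≢0F (trans (sym cᵢ≡1) (c<i i ℕₚ.≤-refl))
    where
    cᵢ≡1 : c i ≡ 1F
    cᵢ≡1 = trans (lincomb-injective indep c (δ i) (trans e (sym (lincomb-δ B i))) i) (updateAt-updates i (const 0F))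

  lincomb-≡-zero⇒InSpanPrefix : ∀ (c : Fin k → 𝔽) (B : Fin k → Mat a b) i → SupportBelow (suc (toℕ i)) c →
                                c i ≢ 0F → lincomb c B ≡ zeroM → InSpanPrefix B i (B i)
  lincomb-≡-zero⇒InSpanPrefix c B i c≤i cᵢ≢0 e = fromMember (lincomb-≡-zero⇒member c B i cᵢ≢0 e)
    where
    fromMember : (∃ λ κ → B i ≡ lincomb (λ j → κ * (c [ i ]≔0) j) B) → InSpanPrefix B i (B i)
    fromMember (κ , Bᵢ≡) = (λ j → κ * (c [ i ]≔0) j) , d<i , sym Bᵢ≡
      where
      d<i : SupportBelow (toℕ i) (λ j → κ * (c [ i ]≔0) j)
      d<i j i≤j = trans (cong (κ *_) (erased (j Finₚ.≟ i))) (zeroʳ κ)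
        where
        erased : Dec (j ≡ i) → (c [ i ]≔0) j ≡ 0F
        erased (yes refl) = updateAt-updates i c
        erased (no j≢i)   = trans (updateAt-minimal j i c j≢i) (c≤i j (ℕₚ.≤∧≢⇒< i≤j λ i≡j → j≢i (Finₚ.toℕ-injective (sym i≡j))))

  ∉InSpanPrefix⇒linIndep : ∀ {B : Fin k → Mat a b} → (∀ i → ¬ InSpanPrefix B i (B i)) → LinIndep B
  ∉InSpanPrefix⇒linIndep {k = k} {B = B} B∉ c e = vanishes k ℕₚ.≤-refl λ j k≤j → ⊥-elim (ℕₚ.<⇒≱ (Finₚ.toℕ<n j) k≤j)
    where
    vanishes : ∀ t → t ≤ k → SupportBelow t c → ∀ j → c j ≡ 0F
    vanishes zero    _   c<0   j = c<0 j z≤n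
    vanishes (suc t) t<k c≤t = vanishes t (ℕₚ.<⇒≤ t<k) c<t
      where
      i : Fin k
      i = fromℕ< t<k
      toℕi≡t : toℕ i ≡ t
      toℕi≡t = Finₚ.toℕ-fromℕ< t<k
      cᵢ≡0 : c i ≡ 0F
      cᵢ≡0 = decidable-stable (c i Finₚ.≟ 0F) λ cᵢ≢0 →
        B∉ i (lincomb-≡-zero⇒InSpanPrefix c B i (subst (λ s → SupportBelow (suc s) c) (sym toℕi≡t) c≤t) cᵢ≢0 e)
      c<t : SupportBelow t c
      c<t j t≤j with toℕ j ℕₚ.≟ t
      ... | yes j≡t = subst (λ x → c x ≡ 0F) (Finₚ.toℕ-injective (trans toℕi≡t (sym j≡t))) cᵢ≡0
      ... | no j≢t = c≤t j (ℕₚ.≤∧≢⇒< t≤j (j≢t ∘ sym))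

  -- The lexicographic order

  LexLt-irrefl : ∀ (u : Vec 𝔽 k) → ¬ LexLt u u
  LexLt-irrefl (x ∷ u) (inj₁ x<x)      = Finₚ.<-irrefl refl x<x
  LexLt-irrefl (x ∷ u) (inj₂ (_ , lt)) = LexLt-irrefl u lt

  LexLt-trans : ∀ (u v w : Vec 𝔽 k) → LexLt u v → LexLt v w → LexLt u w
  LexLt-trans [] [] [] () _
  LexLt-trans (x ∷ u) (y ∷ v) (z ∷ w) (inj₁ x<y)         (inj₁ y<z)         = inj₁ (Finₚ.<-trans x<y y<z)
  LexLt-trans (x ∷ u) (y ∷ v) (z ∷ w) (inj₁ x<y)         (inj₂ (refl , _))  = inj₁ x<y
  LexLt-trans (x ∷ u) (y ∷ v) (z ∷ w) (inj₂ (refl , _))  (inj₁ y<z)         = inj₁ y<z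
  LexLt-trans (x ∷ u) (y ∷ v) (z ∷ w) (inj₂ (refl , lt)) (inj₂ (refl , lt′)) = inj₂ (refl , LexLt-trans u v w lt lt′)

  LexLt-trichotomous : ∀ (u v : Vec 𝔽 k) → LexLt u v ⊎ u ≡ v ⊎ LexLt v u
  LexLt-trichotomous [] [] = inj₂ (inj₁ refl)
  LexLt-trichotomous (x ∷ u) (y ∷ v) with Finₚ.<-cmp x y
  ... | tri< x<y _ _ = inj₁ (inj₁ x<y)
  ... | tri> _ _ y<x = inj₂ (inj₂ (inj₁ y<x))
  ... | tri≈ _ refl _ with LexLt-trichotomous u v
  ...   | inj₁ lt          = inj₁ (inj₂ (refl , lt))
  ...   | inj₂ (inj₁ refl) = inj₂ (inj₁ refl)
  ...   | inj₂ (inj₂ gt)   = inj₂ (inj₂ (inj₂ (refl , gt)))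

  All-replicate : ∀ {A : Set} {P : A → Set} {x} n → P x → All P (replicate n x)
  All-replicate zero    Px = All.[]
  All-replicate (suc n) Px = Px All.∷ All-replicate n Px

  ¬LexLt-zeros : ∀ (u v : Vec 𝔽 k) → All (_≡ 0F) v → ¬ LexLt u v
  ¬LexLt-zeros [] [] _ ()
  ¬LexLt-zeros (x ∷ u) (_ ∷ v) (refl All.∷ _) (inj₁ x<0) = ℕₚ.n≮0 (subst (toℕ x <_) toℕ-0F x<0)
  ¬LexLt-zeros (x ∷ u) (y ∷ v) (_ All.∷ v≡0) (inj₂ (_ , lt)) = ¬LexLt-zeros u v v≡0 lt

  concat-injective : ∀ (A B : Mat a b) → concat A ≡ concat B → A ≡ B
  concat-injective [] [] e = refl
  concat-injective (r ∷ A) (s ∷ B) e with Vecₚ.++-injective r s e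
  ... | refl , e′ = cong (r ∷_) (concat-injective A B e′)

  ⪯-trans : ∀ {A B C : Mat a b} → A ⪯ B → B ⪯ C → A ⪯ C
  ⪯-trans (inj₁ A≺B) (inj₁ B≺C) = inj₁ (LexLt-trans _ _ _ A≺B B≺C)
  ⪯-trans (inj₁ A≺B) (inj₂ refl) = inj₁ A≺B
  ⪯-trans (inj₂ refl) B⪯C = B⪯C

  ⪯-antisym : ∀ {A B : Mat a b} → A ⪯ B → B ⪯ A → A ≡ B
  ⪯-antisym (inj₂ A≡B) _ = A≡B
  ⪯-antisym (inj₁ A≺B) (inj₂ B≡A) = sym B≡A
  ⪯-antisym (inj₁ A≺B) (inj₁ B≺A) = ⊥-elim (LexLt-irrefl _ (LexLt-trans _ _ _ A≺B B≺A))

  ⪯-total : ∀ (A B : Mat a b) → A ⪯ B ⊎ B ≺ A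
  ⪯-total A B with LexLt-trichotomous (concat A) (concat B)
  ... | inj₁ A≺B        = inj₁ (inj₁ A≺B)
  ... | inj₂ (inj₁ A≡B) = inj₁ (inj₂ (concat-injective A B A≡B))
  ... | inj₂ (inj₂ B≺A) = inj₂ B≺A

  ⪯-zeroM⇒≡zeroM : ∀ {A : Mat a b} → A ⪯ zeroM → A ≡ zeroM
  ⪯-zeroM⇒≡zeroM {a} {b} (inj₁ A≺0) =
    ⊥-elim (¬LexLt-zeros _ _ (concat⁺ (All-replicate a (All-replicate b refl))) A≺0)
  ⪯-zeroM⇒≡zeroM (inj₂ A≡0) = A≡0

  argmin : ∀ n (Q : Fin n → Set) → (∀ x → Dec (Q x)) → (key : Fin n → Mat a b) →
           (∀ x → ¬ Q x) ⊎ Σ (Fin n) λ x → Q x × (∀ y → Q y → key x ⪯ key y)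
  argmin zero Q Q? key = inj₁ λ ()
  argmin (suc n) Q Q? key with argmin n (Q ∘ Fin.suc) (Q? ∘ Fin.suc) (key ∘ Fin.suc) | Q? Fin.zero
  ... | inj₁ none | no ¬Q₀ = inj₁ λ where
    Fin.zero    → ¬Q₀
    (Fin.suc y) → none y
  ... | inj₁ none | yes Q₀ = inj₂ (Fin.zero , Q₀ , λ where
    Fin.zero    _  → inj₂ refl
    (Fin.suc y) Qy → ⊥-elim (none y Qy))
  ... | inj₂ (x , Qx , min) | no ¬Q₀ = inj₂ (Fin.suc x , Qx , λ where
    Fin.zero    Q₀ → ⊥-elim (¬Q₀ Q₀)
    (Fin.suc y) Qy → min y Qy)
  ... | inj₂ (x , Qx , min) | yes Q₀ with ⪯-total (key Fin.zero) (key (Fin.suc x))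
  ...   | inj₁ k₀⪯ = inj₂ (Fin.zero , Q₀ , λ where
    Fin.zero    _  → inj₂ refl
    (Fin.suc y) Qy → ⪯-trans k₀⪯ (min y Qy))
  ...   | inj₂ ≺k₀ = inj₂ (Fin.suc x , Qx , λ where
    Fin.zero    _  → inj₁ ≺k₀
    (Fin.suc y) Qy → min y Qy)

  -- Semi-canonical bases

  module SemiCanonicalBases {m n α β d z} (𝒜 : Mat m n → Set) (𝒜-subspace : IsSubspace 𝒜) (𝒜-dim : HasDim 𝒜 d)
                            (L : Mat α m) (R : Mat n β) (Z-dim : HasDim (ZeroLR L R 𝒜) z) where

    LAR : Mat m n → Mat α β
    LAR A = (L ⊗ A) ⊗ R

    LAR-⊞ : ∀ A B → LAR (A ⊞ B) ≡ LAR A ⊞ LAR B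
    LAR-⊞ A B = trans (cong (_⊗ R) (⊗-distribˡ-⊞ L A B)) (⊗-distribʳ-⊞ (L ⊗ A) (L ⊗ B) R)

    LAR-⊡ : ∀ x A → LAR (x ⊡ A) ≡ x ⊡ LAR A
    LAR-⊡ x A = trans (cong (_⊗ R) (⊗-⊡ʳ L x A)) (⊗-⊡ˡ x (L ⊗ A) R)

    LAR-zeroM : LAR zeroM ≡ zeroM
    LAR-zeroM = trans (cong LAR (sym (⊡-zeroˡ zeroM))) (trans (LAR-⊡ 0F zeroM) (⊡-zeroˡ _))

    Ker : Mat m n → Set
    Ker A = 𝒜 A × LAR A ≡ zeroM

    𝒜-⊞ : ∀ A B → 𝒜 A → 𝒜 B → 𝒜 (A ⊞ B)
    𝒜-⊞ = proj₁ (proj₂ 𝒜-subspace)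

    𝒜-⊡ : ∀ x A → 𝒜 A → 𝒜 (x ⊡ A)
    𝒜-⊡ = proj₂ (proj₂ 𝒜-subspace)

    Ker-isSubspace : IsSubspace Ker
    Ker-isSubspace =
      (proj₁ 𝒜-subspace , LAR-zeroM) ,
      (λ A B (A∈𝒜 , LARA≡0) (B∈𝒜 , LARB≡0) →
         𝒜-⊞ A B A∈𝒜 B∈𝒜 , trans (LAR-⊞ A B) (trans (cong₂ _⊞_ LARA≡0 LARB≡0) (⊞-identityˡ zeroM))) ,
      (λ x A (A∈𝒜 , LARA≡0) → 𝒜-⊡ x A A∈𝒜 , trans (LAR-⊡ x A) (trans (cong (x ⊡_) LARA≡0) (⊡-zeroʳ x)))

    Ker-⊟ : ∀ {A A′} → 𝒜 A → 𝒜 A′ → LAR A ≡ LAR A′ → Ker (A ⊟ A′)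
    Ker-⊟ {A} {A′} A∈𝒜 A′∈𝒜 e =
      𝒜-⊞ _ _ A∈𝒜 (𝒜-⊡ (- 1F) A′ A′∈𝒜) ,
      trans (LAR-⊞ A _) (trans (cong₂ _⊞_ e (LAR-⊡ (- 1F) A′)) (⊟-self (LAR A′)))

    ZeroLR⇒Ker : ∀ {C} → ZeroLR L R 𝒜 C → Ker C
    ZeroLR⇒Ker {C} (_ , G , G⊆Ker , C∈G) = InSpan-closed Ker-isSubspace G G⊆Ker C C∈G

    Ker⇒ZeroLR : ∀ {C} → Ker C → ZeroLR L R 𝒜 C
    Ker⇒ZeroLR {C} C∈Ker = 1 , const C , const C∈Ker , const 1F , trans (⊞-identityʳ _) (⊡-identityˡ C)

    E : Fin d → Mat m n
    E = proj₁ 𝒜-dim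

    E-𝒜 : ∀ j → 𝒜 (E j)
    E-𝒜 = proj₁ (proj₂ 𝒜-dim)

    E-linIndep : LinIndep E
    E-linIndep = proj₁ (proj₂ (proj₂ 𝒜-dim))

    𝒜⊆⟨E⟩ : ∀ A → 𝒜 A → InSpan E A
    𝒜⊆⟨E⟩ = proj₂ (proj₂ (proj₂ 𝒜-dim))

    Z : Fin z → Mat m n
    Z = proj₁ Z-dim

    Z-Ker : ∀ j → Ker (Z j)
    Z-Ker j = ZeroLR⇒Ker (proj₁ (proj₂ Z-dim) j)

    Z-linIndep : LinIndep Z
    Z-linIndep = proj₁ (proj₂ (proj₂ Z-dim))

    Ker⊆⟨Z⟩ : ∀ {C} → Ker C → InSpan Z C
    Ker⊆⟨Z⟩ C∈Ker = proj₂ (proj₂ (proj₂ Z-dim)) _ (Ker⇒ZeroLR C∈Ker)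

    z≤d : z ≤ d
    z≤d = steinitz Z-linIndep λ j → 𝒜⊆⟨E⟩ _ (proj₁ (Z-Ker j))

    member : Fin (p ℕ.^ d) → Mat m n
    member x = lincomb (finToFun x) E

    member-funToFin : ∀ c → member (funToFin c) ≡ lincomb c E
    member-funToFin c = lincomb-congˡ E (Finₚ.finToFun-funToFin c)

    SemiCanonical⇒linIndep : ∀ {B : Fin d → Mat m n} → SemiCanonical 𝒜 L R B → LinIndep B
    SemiCanonical⇒linIndep {B} (_ , 𝒜⊆⟨B⟩ , _) = spanning⇒linIndep B E E-linIndep λ j → 𝒜⊆⟨B⟩ (E j) (E-𝒜 j)

    -- Below z, a member of zero_{L,R}(𝒜) outside the prefix span would give L Bᵢ R ⪯ 0.
    SemiCanonical⇒LAR≡0 : ∀ {B : Fin d → Mat m n} → SemiCanonical 𝒜 L R B → ∀ i → toℕ i < z → LAR (B i) ≡ zeroM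
    SemiCanonical⇒LAR≡0 {B} (_ , _ , B-min) i i<z = decidable-stable (LAR (B i) ≟M zeroM) λ LARBᵢ≢0 →
      ℕₚ.<⇒≱ i<z (steinitz Z-linIndep λ j → InSpanBelow⇒InSpan-prefix i≤d B (Zⱼ∈⟨B<i⟩ LARBᵢ≢0 j))
      where
      i≤d : toℕ i ≤ d
      i≤d = ℕₚ.<⇒≤ (Finₚ.toℕ<n i)
      Zⱼ∈⟨B<i⟩ : LAR (B i) ≢ zeroM → ∀ j → InSpanPrefix B i (Z j)
      Zⱼ∈⟨B<i⟩ LARBᵢ≢0 j = decidable-stable (InSpanBelow? (toℕ i) B (Z j)) λ Zⱼ∉ →
        LARBᵢ≢0 (⪯-zeroM⇒≡zeroM (subst (LAR (B i) ⪯_) (proj₂ (Z-Ker j)) (B-min i (Z j) (proj₁ (Z-Ker j)) Zⱼ∉)))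

    SemiCanonical⇒Ker⊆⟨B<z⟩ : ∀ {B : Fin d → Mat m n} → SemiCanonical 𝒜 L R B → ∀ {C} → Ker C → InSpanBelow z B C
    SemiCanonical⇒Ker⊆⟨B<z⟩ {B} sc {C} C∈Ker =
      InSpan-prefix⇒InSpanBelow z≤d B
        (linIndep⇒spanning (prefix z≤d B) Z (prefix-linIndep z≤d (SemiCanonical⇒linIndep sc)) (Ker⊆⟨Z⟩ ∘ B<z-Ker) C (Ker⊆⟨Z⟩ C∈Ker))
      where
      B<z-Ker : ∀ j → Ker (prefix z≤d B j)
      B<z-Ker j = proj₁ sc _ , SemiCanonical⇒LAR≡0 sc _ (subst (_< z) (sym (Finₚ.toℕ-inject≤ j z≤d)) (Finₚ.toℕ<n j))

    SemiCanonical⇒LAR≢0 : ∀ {B : Fin d → Mat m n} → SemiCanonical 𝒜 L R B → ∀ i → z ≤ toℕ i → LAR (B i) ≢ zeroM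
    SemiCanonical⇒LAR≢0 sc i z≤i LARBᵢ≡0 = linIndep⇒∉InSpanPrefix (SemiCanonical⇒linIndep sc) i
      (InSpanBelow-mono z≤i (SemiCanonical⇒Ker⊆⟨B<z⟩ sc (proj₁ sc i , LARBᵢ≡0)))

    -- Past z, agreement of the images below i puts ⟨X<i⟩ inside ⟨Y<i⟩, the differences lying in Ker = ⟨Y<z⟩.
    ∉InSpanPrefix-transfer : ∀ {X Y : Fin d → Mat m n} → SemiCanonical 𝒜 L R X → SemiCanonical 𝒜 L R Y → ∀ i → z ≤ toℕ i →
                             (∀ j → toℕ j < toℕ i → LAR (X j) ≡ LAR (Y j)) → ¬ InSpanPrefix X i (Y i)
    ∉InSpanPrefix-transfer {X} {Y} scX scY i z≤i agree Yᵢ∈⟨X<i⟩ =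
      linIndep⇒∉InSpanPrefix (SemiCanonical⇒linIndep scY) i
        (InSpanBelow-⊆ (ℕₚ.<⇒≤ (Finₚ.toℕ<n i)) X<i⊆⟨Y<i⟩ Yᵢ∈⟨X<i⟩)
      where
      X<i⊆⟨Y<i⟩ : ∀ j → toℕ j < toℕ i → InSpanPrefix Y i (X j)
      X<i⊆⟨Y<i⟩ j j<i = subst (InSpanPrefix Y i) (B⊞[A⊟B]≡A (X j) (Y j))
        (proj₁ (proj₂ (InSpanBelow-isSubspace (toℕ i) Y)) _ _
          (InSpanBelow-member Y j<i)
          (InSpanBelow-mono z≤i (SemiCanonical⇒Ker⊆⟨B<z⟩ scY (Ker-⊟ (proj₁ scX j) (proj₁ scY j) (agree j j<i)))))

    SemiCanonical⇒LAR-unique : ∀ {B B′ : Fin d → Mat m n} → SemiCanonical 𝒜 L R B → SemiCanonical 𝒜 L R B′ → ∀ i → LAR (B i) ≡ LAR (B′ i)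
    SemiCanonical⇒LAR-unique {B} {B′} sc sc′ = WF.All.wfRec FinInduction.<-wellFounded _ _ λ i IH → step i IH (toℕ i ℕₚ.<? z)
      where
      step : ∀ i → (∀ {j} → j Fin.< i → LAR (B j) ≡ LAR (B′ j)) → Dec (toℕ i < z) → LAR (B i) ≡ LAR (B′ i)
      step i IH (yes i<z) = trans (SemiCanonical⇒LAR≡0 sc i i<z) (sym (SemiCanonical⇒LAR≡0 sc′ i i<z))
      step i IH (no i≮z) = ⪯-antisym
        (proj₂ (proj₂ sc) i (B′ i) (proj₁ sc′ i) (∉InSpanPrefix-transfer sc sc′ i z≤i λ _ → IH))
        (proj₂ (proj₂ sc′) i (B i) (proj₁ sc i) (∉InSpanPrefix-transfer sc′ sc i z≤i λ _ j<i → sym (IH j<i)))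
        where
        z≤i : z ≤ toℕ i
        z≤i = ℕₚ.≮⇒≥ i≮z

    SemiCanonical⇒differ-in-ZeroLR : ∀ {B B′ : Fin d → Mat m n} → SemiCanonical 𝒜 L R B → SemiCanonical 𝒜 L R B′ →
                                    ∀ i → ∃ λ C → ZeroLR L R 𝒜 C × B i ≡ B′ i ⊞ C
    SemiCanonical⇒differ-in-ZeroLR {B} {B′} sc sc′ i =
      B i ⊟ B′ i ,
      Ker⇒ZeroLR (Ker-⊟ (proj₁ sc i) (proj₁ sc′ i) (SemiCanonical⇒LAR-unique sc sc′ i)) ,
      sym (B⊞[A⊟B]≡A (B i) (B′ i))

    IsMinimalAt : (Fin d → Mat m n) → Fin d → Mat m n → Set
    IsMinimalAt G i A = 𝒜 A × ¬ InSpanPrefix G i A × (∀ A′ → 𝒜 A′ → ¬ InSpanPrefix G i A′ → LAR A ⪯ LAR A′)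

    -- A lexicographic minimum over the p ^ d members of 𝒜, which exist outside ⟨G<i⟩ since i < d = dim 𝒜.
    minimalAt : ∀ G i → Σ (Mat m n) (IsMinimalAt G i)
    minimalAt G i = [ ⊥-elim ∘ all-inside , fromMinimum ]′ (argmin (p ℕ.^ d) Outside (λ x → ¬? (InSpanBelow? _ G (member x))) (LAR ∘ member))
      where
      Outside : Fin (p ℕ.^ d) → Set
      Outside x = ¬ InSpanPrefix G i (member x)

      all-inside : (∀ x → ¬ Outside x) → ⊥
      all-inside inside = ℕₚ.<⇒≱ (Finₚ.toℕ<n i) (steinitz E-linIndep λ j → InSpanBelow⇒InSpan-prefix i≤d G (Eⱼ∈⟨G<i⟩ j))
        where
        i≤d : toℕ i ≤ d
        i≤d = ℕₚ.<⇒≤ (Finₚ.toℕ<n i)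
        Eⱼ∈⟨G<i⟩ : ∀ j → InSpanPrefix G i (E j)
        Eⱼ∈⟨G<i⟩ j = decidable-stable (InSpanBelow? _ G (E j)) λ Eⱼ∉ →
          inside (funToFin (δ j)) (λ δⱼ∈ → Eⱼ∉ (subst (InSpanPrefix G i) (trans (member-funToFin (δ j)) (lincomb-δ E j)) δⱼ∈))

      fromMinimum : Σ (Fin (p ℕ.^ d)) (λ x → Outside x × (∀ y → Outside y → LAR (member x) ⪯ LAR (member y))) →
                    Σ (Mat m n) (IsMinimalAt G i)
      fromMinimum (x , x∉ , x-min) = member x , InSpan-closed 𝒜-subspace E E-𝒜 _ (finToFun x , refl) , x∉ , least
        where
        least : ∀ A′ → 𝒜 A′ → ¬ InSpanPrefix G i A′ → LAR (member x) ⪯ LAR A′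
        least A′ A′∈𝒜 A′∉ = subst (λ Y → LAR (member x) ⪯ LAR Y) code≡A′
          (x-min (funToFin c′) λ h → A′∉ (subst (InSpanPrefix G i) code≡A′ h))
          where
          c′ : Fin d → 𝔽
          c′ = proj₁ (𝒜⊆⟨E⟩ A′ A′∈𝒜)
          code≡A′ : member (funToFin c′) ≡ A′
          code≡A′ = trans (member-funToFin c′) (proj₂ (𝒜⊆⟨E⟩ A′ A′∈𝒜))

    InSpanPrefix-cong : ∀ {G G′ : Fin d → Mat m n} i → (∀ j → toℕ j < toℕ i → G j ≡ G′ j) →
                        ∀ {A} → InSpanPrefix G i A → InSpanPrefix G′ i A
    InSpanPrefix-cong {G} {G′} i agree (c , c<i , e) = c , c<i , trans (lincomb-cong λ j → same-term j (toℕ i ℕₚ.≤? toℕ j)) e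
      where
      same-term : ∀ j → Dec (toℕ i ≤ toℕ j) → c j ⊡ G′ j ≡ c j ⊡ G j
      same-term j (yes i≤j) = trans (cong (_⊡ G′ j) (c<i j i≤j)) (trans (⊡-zeroˡ _) (sym (trans (cong (_⊡ G j) (c<i j i≤j)) (⊡-zeroˡ _))))
      same-term j (no i≰j)  = cong (c j ⊡_) (sym (agree j (ℕₚ.≰⇒> i≰j)))

    IsMinimalAt-cong : ∀ {G G′ : Fin d → Mat m n} i → (∀ j → toℕ j < toℕ i → G j ≡ G′ j) →
                       ∀ {A} → IsMinimalAt G i A → IsMinimalAt G′ i A
    IsMinimalAt-cong i agree (A∈𝒜 , A∉ , A-min) =
      A∈𝒜 , A∉ ∘ InSpanPrefix-cong i (λ j j<i → sym (agree j j<i)) , λ A′ A′∈𝒜 A′∉ → A-min A′ A′∈𝒜 (A′∉ ∘ InSpanPrefix-cong i agree)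

    module Existence (z≡0 : z ≡ 0) where

      LAR-injective : ∀ {A A′} → 𝒜 A → 𝒜 A′ → LAR A ≡ LAR A′ → A ≡ A′
      LAR-injective {A} {A′} A∈𝒜 A′∈𝒜 e = A⊟B≡0⇒A≡B A A′ (⟨Z⟩≡0 z≡0 (Ker⊆⟨Z⟩ (Ker-⊟ A∈𝒜 A′∈𝒜 e)))
        where
        ⟨Z⟩≡0 : ∀ {C} → z ≡ 0 → InSpan Z C → C ≡ zeroM
        ⟨Z⟩≡0 refl (c , e) = sym e

      IsMinimalAt-unique : ∀ G i {A A′} → IsMinimalAt G i A → IsMinimalAt G i A′ → A ≡ A′
      IsMinimalAt-unique G i (A∈𝒜 , A∉ , A-min) (A′∈𝒜 , A′∉ , A′-min) =
        LAR-injective A∈𝒜 A′∈𝒜 (⪯-antisym (A-min _ A′∈𝒜 A′∉) (A′-min _ A∈𝒜 A∉))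

      -- Round t + 1 minimises against round t; index j is settled from round j + 1 on.
      greedy : ℕ → Fin d → Mat m n
      greedy zero    = const zeroM
      greedy (suc t) = λ i → proj₁ (minimalAt (greedy t) i)

      greedy-stable : ∀ t j → toℕ j < t → greedy (suc t) j ≡ greedy t j
      greedy-stable (suc t) j j<t+1 = IsMinimalAt-unique (greedy (suc t)) j (proj₂ (minimalAt (greedy (suc t)) j))
        (IsMinimalAt-cong j (λ l l<j → sym (greedy-stable t l (ℕₚ.<-≤-trans l<j (ℕ.s≤s⁻¹ j<t+1)))) (proj₂ (minimalAt (greedy t) j)))

      basis : Fin d → Mat m n
      basis = greedy (suc d)

      basis-minimal : ∀ i → IsMinimalAt basis i (basis i)
      basis-minimal i = IsMinimalAt-cong i (λ j _ → sym (greedy-stable d j (Finₚ.toℕ<n j))) (proj₂ (minimalAt (greedy d) i))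

      basis-semiCanonical : SemiCanonical 𝒜 L R basis
      basis-semiCanonical =
        proj₁ ∘ basis-minimal ,
        (λ A A∈𝒜 → linIndep⇒spanning basis E basis-linIndep (λ j → 𝒜⊆⟨E⟩ _ (proj₁ (basis-minimal j))) A (𝒜⊆⟨E⟩ A A∈𝒜)) ,
        (λ i → proj₂ (proj₂ (basis-minimal i)))
        where
        basis-linIndep : LinIndep basis
        basis-linIndep = ∉InSpanPrefix⇒linIndep λ i → proj₁ (proj₂ (basis-minimal i))

      SemiCanonical-unique : ∀ {B : Fin d → Mat m n} → SemiCanonical 𝒜 L R B → ∀ i → B i ≡ basis i
      SemiCanonical-unique sc i =
        LAR-injective (proj₁ sc i) (proj₁ basis-semiCanonical i) (SemiCanonical⇒LAR-unique sc basis-semiCanonical i)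


lemma3p4 : (p : ℕ) (pr : Prime p) → let open FF p pr in
    (m n α β d z : ℕ) → 1 ≤ α → 1 ≤ β → 1 ≤ d →
    (𝒜 : Mat m n → Set) → IsSubspace 𝒜 → HasDim 𝒜 d →
    (L : Mat α m) (R : Mat n β) → HasDim (ZeroLR L R 𝒜) z →
    (z ≡ 0 →
      Σ (Fin d → Mat m n) λ B → SemiCanonical 𝒜 L R B ×
        ((B′ : Fin d → Mat m n) → SemiCanonical 𝒜 L R B′ → ∀ i → B′ i ≡ B i))
    × (0 < z →
      ((B : Fin d → Mat m n) → SemiCanonical 𝒜 L R B →
        (∀ i → toℕ i < z → (L ⊗ B i) ⊗ R ≡ zeroM)
        × (∀ i → z ≤ toℕ i → (L ⊗ B i) ⊗ R ≢ zeroM))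
      × ((B B′ : Fin d → Mat m n) → SemiCanonical 𝒜 L R B → SemiCanonical 𝒜 L R B′ →
        ∀ i → ∃ λ C → ZeroLR L R 𝒜 C × B i ≡ B′ i +M C))
lemma3p4 p pr m n α β d z _ _ _ 𝒜 𝒜-subspace 𝒜-dim L R Z-dim =
  (λ z≡0 → basis z≡0 , basis-semiCanonical z≡0 , λ _ → SemiCanonical-unique z≡0) ,
  (λ _ → (λ _ sc → SemiCanonical⇒LAR≡0 sc , SemiCanonical⇒LAR≢0 sc) , λ _ _ → SemiCanonical⇒differ-in-ZeroLR)
  where
  open MatrixSpaces p pr
  open SemiCanonicalBases 𝒜 𝒜-subspace 𝒜-dim L R Z-dim
  open Existence
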